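{- For an integer $j\ge -1$ let $T_j(z)$ be the generating function, by number of internal nodes, of naturally embedded ternary trees in which no internal node has a label greater than $j$; in particular $T_{ -1}(z)=1$. Then $$T_j(z)=1+z\,T_{j-1}(z)\,T_j(z)\,T_{j+1}(z)\qquad\text{for } j=0,1,2,\dots,$$ with $T_{ -1}(z)=1$.
   Context: A ternary tree is either an external node (leaf) or an internal node with three ordered subtrees (left, center, right), each a ternary tree; the size of a tree is its number of internal nodes. In the natural embedding, the root has label $0$, and the left, center and right children (internal or external) of a node with label $j\in\mathbb{Z}$ have labels $j-1$, $j$, $j+1$ respectively. The condition "no label greater than $j$" refers to labels of internal nodes. -}

module Defs where

open import Data.Nat using (ℕ; zero; suc; _+_; _*_; _∸_)
open import Data.Integer using (ℤ; _≤_; +_; -[1+_]) renaming (_+_ to _+ℤ_; _-_ to _-ℤ_)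
open import Data.List using (map; upTo)
open import Data.Nat.ListAction using (sum)
open import Data.Product using (Σ; _×_)
open import Data.Unit using (⊤)
open import Relation.Binary.PropositionalEquality using (_≡_)

data Tree : Set where
  leaf : Tree
  node : Tree → Tree → Tree → Tree

size : Tree → ℕ
size leaf = 0
size (node l c r) = suc (size l + size c + size r)

-- Natural embedding: `LabelsAtMost j ℓ t` says that in the subtree t whose root
-- carries label ℓ, every internal node has label ≤ j
-- (children of a node labelled ℓ get labels ℓ-1, ℓ, ℓ+1).
LabelsAtMost : ℤ → ℤ → Tree → Set
LabelsAtMost j ℓ leaf = ⊤
LabelsAtMost j ℓ (node l c r) =
  (ℓ ≤ j) × LabelsAtMost j (ℓ -ℤ + 1) l × LabelsAtMost j ℓ c × LabelsAtMost j (ℓ +ℤ + 1) r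

NoLabelAbove : ℤ → Tree → Set
NoLabelAbove j t = LabelsAtMost j (+ 0) t

Trees : ℤ → ℕ → Set
Trees j n = Σ Tree (λ t → size t ≡ n × NoLabelAbove j t)

Series : Set
Series = ℕ → ℕ

one : Series
one zero = 1
one (suc n) = 0

zTimes : Series → Series
zTimes f zero = 0
zTimes f (suc n) = f n

_⊕_ : Series → Series → Series
(f ⊕ g) n = f n + g n

_⊛_ : Series → Series → Series
(f ⊛ g) n = sum (map (λ k → f k * g (n ∸ k)) (upTo (suc n)))

infixl 7 _⊛_
infixl 6 _⊕_

module Submission where

-- A subtree rooted at label ℓ obeys the bound j exactly when a tree rooted at 0 obeys the bound j - ℓ,
-- so the three subtrees of a root labelled 0 are counted by T (j + 1), T j and T (j - 1). Removing the
-- root therefore identifies the trees of size n + 1 with triples of trees of total size n, and counting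
-- turns this bijection into the Cauchy product of the three series. For j = -1 not even the root fits.

open import Defs
open import Data.Nat using (ℕ)
open import Data.Integer using (ℤ; _≤_; +_; -[1+_]; _+_; _-_)
open import Data.Product using (_×_)
open import Data.Fin using (Fin)
open import Function.Bundles using (_↔_)
open import Relation.Binary.PropositionalEquality using (_≡_)

open import Data.Nat using (suc) renaming (_+_ to _+ℕ_; _*_ to _*ℕ_; _∸_ to _∸ℕ_)
import Data.Nat.Properties as ℕ
import Data.Nat.Tactic.RingSolver as ℕ-Solver
import Data.Integer.Properties as ℤ
open import Data.Integer using (-_; _<_; -≤+; -<+)
open import Data.Integer.Tactic.RingSolver using (solve-∀)
open import Data.Product using (Σ; Σ-syntax; _,_)
open import Data.Sum using (_⊎_; inj₁; inj₂)
open import Data.Empty using (⊥)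
open import Data.Unit using (⊤; tt)
open import Data.List.Properties using (map-upTo)
open import Data.Nat.ListAction using (sum)
open import Data.List using (applyUpTo)
open import Data.Sum.Function.Propositional using (_⊎-↔_)
open import Data.Product.Function.NonDependent.Propositional using (_×-↔_)
open import Data.Fin.Properties using (+↔⊎; *↔×; 0↔⊥; 1↔⊤)
open import Data.Fin.Permutation using (↔⇒≡)
open import Function.Bundles using (mk↔ₛ′)
open import Function.Properties.Inverse using (↔-trans; ↔-sym)
open import Relation.Nullary using (Irrelevant; contradiction)
open import Relation.Binary.PropositionalEquality using (refl; sym; trans; cong; cong₂; subst)

_⋆_ : (ℕ → Set) → (ℕ → Set) → ℕ → Set
(A ⋆ B) n = Σ[ a ∈ ℕ ] Σ[ b ∈ ℕ ] (a +ℕ b ≡ n) × A a × B b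

infixl 7 _⋆_

Counts : (ℕ → Set) → Series → Set
Counts A f = ∀ n → Fin (f n) ↔ A n

cardinality-unique : ∀ {A : Set} {m n} → Fin m ↔ A → Fin n ↔ A → m ≡ n
cardinality-unique p q = ↔⇒≡ (↔-trans p (↔-sym q))

counts-↔ : ∀ {A B f} → Counts A f → (∀ n → A n ↔ B n) → Counts B f
counts-↔ count A↔B n = ↔-trans (count n) (A↔B n)

module _ {A B : ℕ → Set} where

  ⋆-zero : (A ⋆ B) 0 ↔ ((A 0 × B 0) ⊎ ⊥)
  ⋆-zero = mk↔ₛ′ to from (λ { (inj₁ _) → refl }) (λ { (0 , 0 , refl , _) → refl })
    where
    to : (A ⋆ B) 0 → (A 0 × B 0) ⊎ ⊥
    to (0 , 0 , refl , x , y) = inj₁ (x , y)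
    from : (A 0 × B 0) ⊎ ⊥ → (A ⋆ B) 0
    from (inj₁ (x , y)) = 0 , 0 , refl , x , y

  ⋆-suc : ∀ n → (A ⋆ B) (suc n) ↔ ((A 0 × B (suc n)) ⊎ ((λ k → A (suc k)) ⋆ B) n)
  ⋆-suc n = mk↔ₛ′ to from
    (λ { (inj₁ _) → refl ; (inj₂ (_ , _ , refl , _)) → refl })
    (λ { (0 , _ , refl , _) → refl ; (suc _ , _ , refl , _) → refl })
    where
    to : (A ⋆ B) (suc n) → (A 0 × B (suc n)) ⊎ ((λ k → A (suc k)) ⋆ B) n
    to (0 , _ , refl , x , y) = inj₁ (x , y)
    to (suc a , b , refl , x , y) = inj₂ (a , b , refl , x , y)
    from : (A 0 × B (suc n)) ⊎ ((λ k → A (suc k)) ⋆ B) n → (A ⋆ B) (suc n)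
    from (inj₁ (x , y)) = 0 , suc n , refl , x , y
    from (inj₂ (a , b , refl , x , y)) = suc a , b , refl , x , y

counts-applyUpTo-⋆ : ∀ {A B f g} → Counts A f → Counts B g → ∀ n →
                     Fin (sum (applyUpTo (λ k → f k *ℕ g (n ∸ℕ k)) (suc n))) ↔ (A ⋆ B) n
counts-applyUpTo-⋆ cA cB 0 =
  ↔-trans +↔⊎ (↔-trans ((↔-trans *↔× (cA 0 ×-↔ cB 0)) ⊎-↔ 0↔⊥) (↔-sym ⋆-zero))
counts-applyUpTo-⋆ cA cB (suc n) =
  ↔-trans +↔⊎ (↔-trans ((↔-trans *↔× (cA 0 ×-↔ cB (suc n))) ⊎-↔ counts-applyUpTo-⋆ (λ k → cA (suc k)) cB n)
                       (↔-sym (⋆-suc n)))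

counts-⋆ : ∀ {A B f g} → Counts A f → Counts B g → Counts (A ⋆ B) (f ⊛ g)
counts-⋆ {A} {B} {f} {g} cA cB n =
  subst (λ m → Fin m ↔ (A ⋆ B) n) (sym (cong sum (map-upTo (λ k → f k *ℕ g (n ∸ℕ k)) (suc n))))
        (counts-applyUpTo-⋆ cA cB n)

Subtrees : ℤ → ℤ → ℕ → Set
Subtrees j ℓ n = Σ Tree λ t → size t ≡ n × LabelsAtMost j ℓ t

labelsAtMost-irrelevant : ∀ j ℓ t → Irrelevant (LabelsAtMost j ℓ t)
labelsAtMost-irrelevant j ℓ leaf tt tt = refl
labelsAtMost-irrelevant j ℓ (node l c r) (a , pl , pc , pr) (a′ , pl′ , pc′ , pr′)
  rewrite ℤ.≤-irrelevant a a′
        | labelsAtMost-irrelevant j _ l pl pl′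
        | labelsAtMost-irrelevant j ℓ c pc pc′
        | labelsAtMost-irrelevant j _ r pr pr′ = refl

labelsAtMost-headroom : ∀ {j ℓ j′ ℓ′} t → j - ℓ ≡ j′ - ℓ′ → LabelsAtMost j ℓ t → LabelsAtMost j′ ℓ′ t
labelsAtMost-headroom leaf _ _ = tt
labelsAtMost-headroom {j} {ℓ} {j′} {ℓ′} (node l c r) eq (ℓ≤j , pl , pc , pr) =
  ℤ.0≤i-j⇒j≤i (subst (+ 0 ≤_) eq (ℤ.i≤j⇒0≤j-i ℓ≤j)) ,
  labelsAtMost-headroom l (trans (pred-headroom j ℓ) (trans (cong (_+ + 1) eq) (sym (pred-headroom j′ ℓ′)))) pl ,
  labelsAtMost-headroom c eq pc ,
  labelsAtMost-headroom r (trans (suc-headroom j ℓ) (trans (cong (_- + 1) eq) (sym (suc-headroom j′ ℓ′)))) pr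
  where
  pred-headroom : ∀ j ℓ → j - (ℓ - + 1) ≡ (j - ℓ) + + 1
  pred-headroom = solve-∀
  suc-headroom : ∀ j ℓ → j - (ℓ + + 1) ≡ (j - ℓ) - + 1
  suc-headroom = solve-∀

subtrees-headroom : ∀ {j ℓ j′ ℓ′} → j - ℓ ≡ j′ - ℓ′ → ∀ n → Subtrees j ℓ n ↔ Subtrees j′ ℓ′ n
subtrees-headroom {j} {ℓ} {j′} {ℓ′} eq n = mk↔ₛ′ to from to∘from from∘to
  where
  to : Subtrees j ℓ n → Subtrees j′ ℓ′ n
  to (t , size≡ , p) = t , size≡ , labelsAtMost-headroom t eq p
  from : Subtrees j′ ℓ′ n → Subtrees j ℓ n
  from (t , size≡ , p) = t , size≡ , labelsAtMost-headroom t (sym eq) p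
  to∘from : ∀ x → to (from x) ≡ x
  to∘from (t , size≡ , p) = cong (λ q → t , size≡ , q) (labelsAtMost-irrelevant j′ ℓ′ t _ p)
  from∘to : ∀ x → from (to x) ≡ x
  from∘to (t , size≡ , p) = cong (λ q → t , size≡ , q) (labelsAtMost-irrelevant j ℓ t _ p)

subtrees-leaf : ∀ {j ℓ} → Subtrees j ℓ 0 ↔ ⊤
subtrees-leaf = mk↔ₛ′ (λ _ → tt) (λ _ → leaf , refl , tt) (λ _ → refl)
  (λ { (leaf , refl , tt) → refl ; (node _ _ _ , () , _) })

subtrees-above-bound : ∀ {j ℓ} → j < ℓ → ∀ n → Subtrees j ℓ (suc n) ↔ ⊥
subtrees-above-bound j<ℓ n = mk↔ₛ′ impossible (λ ()) (λ ()) (λ x → contradiction x impossible)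
  where
  impossible : Subtrees _ _ (suc n) → ⊥
  impossible (node _ _ _ , _ , ℓ≤j , _) = ℤ.<⇒≱ j<ℓ ℓ≤j

+-mirror : ∀ a b c → a +ℕ b +ℕ c ≡ c +ℕ b +ℕ a
+-mirror = ℕ-Solver.solve-∀

-- The factors are ordered as in T (j - 1) ⊛ T j ⊛ T (j + 1): the right subtree, rooted one label higher,
-- has the least headroom.
subtrees-root : ∀ {j ℓ} → ℓ ≤ j → ∀ n →
                Subtrees j ℓ (suc n) ↔ (Subtrees j (ℓ + + 1) ⋆ Subtrees j ℓ ⋆ Subtrees j (ℓ - + 1)) n
subtrees-root {j} {ℓ} ℓ≤j n = mk↔ₛ′ split join split∘join join∘split
  where
  Children : ℕ → Set
  Children = Subtrees j (ℓ + + 1) ⋆ Subtrees j ℓ ⋆ Subtrees j (ℓ - + 1)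

  split : Subtrees j ℓ (suc n) → Children n
  split (node l c r , size≡ , _ , pl , pc , pr) =
    _ , _ , trans (+-mirror (size r) (size c) (size l)) (ℕ.suc-injective size≡) ,
    (_ , _ , refl , (r , refl , pr) , (c , refl , pc)) , (l , refl , pl)

  join : Children n → Subtrees j ℓ (suc n)
  join (_ , _ , size≡ , (_ , _ , refl , (r , refl , pr) , (c , refl , pc)) , (l , refl , pl)) =
    node l c r , cong suc (trans (+-mirror (size l) (size c) (size r)) size≡) , ℓ≤j , pl , pc , pr

  split∘join : ∀ x → split (join x) ≡ x
  split∘join (_ , _ , size≡ , (_ , _ , refl , (r , refl , pr) , (c , refl , pc)) , (l , refl , pl)) =
    cong (λ e → _ , _ , e , (_ , _ , refl , (r , refl , pr) , (c , refl , pc)) , (l , refl , pl))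
         (ℕ.≡-irrelevant _ size≡)

  join∘split : ∀ x → join (split x) ≡ x
  join∘split (node l c r , size≡ , ℓ≤j′ , pl , pc , pr) =
    cong₂ (λ e q → node l c r , e , q , pl , pc , pr) (ℕ.≡-irrelevant _ size≡) (ℤ.≤-irrelevant ℓ≤j ℓ≤j′)

lemma1 : (T : ℤ → Series) →
    (∀ (j : ℤ) → -[1+ 0 ] ≤ j → ∀ (n : ℕ) → Fin (T j n) ↔ Trees j n) →
    (∀ (n : ℕ) → T -[1+ 0 ] n ≡ one n) ×
    (∀ (j : ℤ) → + 0 ≤ j → ∀ (n : ℕ) →
    T j n ≡ (one ⊕ zTimes (T (j - + 1) ⊛ T j ⊛ T (j + + 1))) n)
lemma1 T count = T₋₁≡one , recurrence
  where
  leaf-count : ∀ j → Fin 1 ↔ Trees j 0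
  leaf-count j = ↔-trans 1↔⊤ (↔-sym subtrees-leaf)

  T₋₁≡one : ∀ n → T -[1+ 0 ] n ≡ one n
  T₋₁≡one 0 = cardinality-unique (count -[1+ 0 ] ℤ.≤-refl 0) (leaf-count -[1+ 0 ])
  T₋₁≡one (suc n) = cardinality-unique (count -[1+ 0 ] ℤ.≤-refl (suc n))
                      (↔-trans 0↔⊥ (↔-sym (subtrees-above-bound -<+ n)))

  right-headroom : ∀ j → (j - + 1) - + 0 ≡ j - (+ 0 + + 1)
  right-headroom = solve-∀
  left-headroom : ∀ j → (j + + 1) - + 0 ≡ j - (+ 0 - + 1)
  left-headroom = solve-∀

  0≤⇒-1≤ : ∀ {j} → + 0 ≤ j → -[1+ 0 ] ≤ j
  0≤⇒-1≤ = ℤ.≤-trans -≤+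

  recurrence : ∀ j → + 0 ≤ j → ∀ n → T j n ≡ (one ⊕ zTimes (T (j - + 1) ⊛ T j ⊛ T (j + + 1))) n
  -- The right-hand side computes to 1 at size 0, and to the triple Cauchy product at n at size suc n.
  recurrence j 0≤j 0 = cardinality-unique (count j (0≤⇒-1≤ 0≤j) 0) (leaf-count j)
  recurrence j 0≤j (suc n) = cardinality-unique (count j (0≤⇒-1≤ 0≤j) (suc n))
    (↔-trans (counts-⋆ (counts-⋆ right center) left n) (↔-sym (subtrees-root 0≤j n)))
    where
    right : Counts (Subtrees j (+ 0 + + 1)) (T (j - + 1))
    right = counts-↔ (count (j - + 1) (ℤ.+-monoˡ-≤ (- + 1) 0≤j)) (subtrees-headroom (right-headroom j))
    center : Counts (Trees j) (T j)
    center = count j (0≤⇒-1≤ 0≤j)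
    left : Counts (Subtrees j (+ 0 - + 1)) (T (j + + 1))
    left = counts-↔ (count (j + + 1) (0≤⇒-1≤ (ℤ.≤-trans 0≤j (ℤ.i≤i+j j (+ 1))))) (subtrees-headroom (left-headroom j))
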